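{- Let $\eta$ denote the number of path-active vertices in some level-$(r-1)$ subproblem $(G,P)$ of the flattened path-relevant tree, and let $\eta'$ be the random variable denoting the number of those vertices that are path active at level $r$ (i.e. in the children of $(G,P)$ in the flattened tree). Then $E[\eta']<(3/4)\eta$.
   Context: Write $u\preceq v$ for reachability by a directed path. For a path $P$ in $G$, a vertex $x$ is a bridge of $P$ if $v_i\preceq x\preceq v_j$ for some $v_i,v_j\in P$, an ancestor if it reaches some vertex of $P$ but no vertex of $P$ reaches it, a descendant if some vertex of $P$ reaches it but it reaches no vertex of $P$, and is related to $P$ in any of these cases. The randomized procedure $\mathrm{SeqSC1}(G)$ on $G=(V,E)$: if $V=\emptyset$ return; else pick pivot $x\in V$ uniformly at random, let $R^+=\{v:x\preceq v\}$, $R^-=\{u:u\preceq x\}$, add shortcuts $(x,v)$ for $v\in R^+$ and $(u,x)$ for $u\in R^-$, let $V_B=R^+\cap R^-$, $V_S=R^+\setminus V_B$, $V_P=R^-\setminus V_B$, $V_R=V\setminus(V_B\cup V_S\cup V_P)$, and recurse independently on $G[V_S],G[V_P],G[V_R]$. A path-relevant subproblem $(G,P)$ is a call $\mathrm{SeqSC1}(G)$ together with a nonempty path $P$ in $G$; its children given pivot $x$ are: none if $x$ is a bridge; $(G[V_R],P)$ if $x$ is unrelated; if $x$ is an ancestor, $(G[V_R],P_1)$ and $(G[V_S],P_2)$ where $P_1,P_2$ are the (prefix/suffix) parts of $P$ in $V_R$ and $V_S$ (only nonempty ones kept); if $x$ is a descendant, $(G[V_P],P_1)$ and $(G[V_R],P_2)$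 where $P_1,P_2$ are the parts of $P$ in $V_P$ and $V_R$. In the flattened path-relevant tree, each node whose pivot is unrelated to its path is merged with its unique child, so a node corresponds to a sequence of calls ending with the first pivot related to the path. A vertex is path active at a level if it lies in the graph of some subproblem at that level of the flattened tree and is related to that subproblem's path. -}

module Defs where

open import Data.Nat using (ℕ; zero; suc)
open import Data.Bool using (Bool; true; false; _∧_; _∨_; not; if_then_else_)
open import Data.Fin using (Fin)
open import Data.Fin.Subset using (Subset; _∈_; ∣_∣; _∩_; _∪_; ∁)
open import Data.Vec using (lookup; tabulate)
open import Data.List using (List; []; _∷_; filter; foldr; allFin)
open import Data.Bool.ListAction using (any)
open import Data.List.Relation.Unary.Unique.Propositional using (Unique)
open import Data.Product using (_×_; _,_)
open import Data.Integer using (+_)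
open import Data.Rational using (ℚ; 0ℚ; _/_; _+_; _*_)
open import Relation.Nullary using (Dec; does; ¬_)
open import Relation.Binary.PropositionalEquality using (_≡_)

Graph : ℕ → Set
Graph n = Fin n → Fin n → Bool

-- Reachability u ⪯ v by a directed path (possibly of length 0) all of whose
-- vertices lie in S, i.e. reachability in the induced subgraph G[S].
data Reach {n : ℕ} (E : Graph n) (S : Subset n) : Fin n → Fin n → Set where
  here : ∀ {u} → u ∈ S → Reach E S u u
  step : ∀ {u v w} → u ∈ S → E u v ≡ true → Reach E S v w → Reach E S u w

-- A decision procedure for reachability (any two such agree on the answer).
ReachDec : {n : ℕ} → Graph n → Set
ReachDec {n} E = (S : Subset n) (u v : Fin n) → Dec (Reach E S u v)

data Consecutive {n : ℕ} (E : Graph n) : List (Fin n) → Set where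
  [] : Consecutive E []
  [-] : ∀ {u} → Consecutive E (u ∷ [])
  _∷_ : ∀ {u v vs} → E u v ≡ true → Consecutive E (v ∷ vs) → Consecutive E (u ∷ v ∷ vs)

data AllIn {n : ℕ} (S : Subset n) : List (Fin n) → Set where
  [] : AllIn S []
  _∷_ : ∀ {v vs} → v ∈ S → AllIn S vs → AllIn S (v ∷ vs)

record IsPath {n : ℕ} (E : Graph n) (S : Subset n) (P : List (Fin n)) : Set where
  field
    nonempty : ¬ (P ≡ [])
    consecutive : Consecutive E P
    inS : AllIn S P
    distinct : Unique P

module Procedure {n : ℕ} (E : Graph n) (dec : ReachDec E) where

  reach : Subset n → Fin n → Fin n → Bool
  reach S x y = does (dec S x y)

  memb : Subset n → Fin n → Bool
  memb S v = lookup S v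

  reachesP : Subset n → List (Fin n) → Fin n → Bool
  reachesP S P x = any (λ v → reach S x v) P

  reachedByP : Subset n → List (Fin n) → Fin n → Bool
  reachedByP S P x = any (λ v → reach S v x) P

  isBridge isAncestor isDescendant related : Subset n → List (Fin n) → Fin n → Bool
  isBridge S P x = reachedByP S P x ∧ reachesP S P x
  isAncestor S P x = reachesP S P x ∧ not (reachedByP S P x)
  isDescendant S P x = reachedByP S P x ∧ not (reachesP S P x)
  related S P x = reachesP S P x ∨ reachedByP S P x

  active : Subset n → List (Fin n) → Fin n → Bool
  active S P v = memb S v ∧ related S P v

  -- the sets of one call of SeqSC1 on G[S] with pivot x
  R⁺ R⁻ VB VS VP VR : Subset n → Fin n → Subset n
  R⁺ S x = tabulate (λ v → reach S x v)
  R⁻ S x = tabulate (λ u → reach S u x)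
  VB S x = R⁺ S x ∩ R⁻ S x
  VS S x = R⁺ S x ∩ ∁ (VB S x)
  VP S x = R⁻ S x ∩ ∁ (VB S x)
  VR S x = S ∩ ∁ (R⁺ S x ∪ R⁻ S x)

  partIn : Subset n → List (Fin n) → List (Fin n)
  partIn T P = filter (λ v → Data.Bool._≟_ (lookup T v) true) P

  keep : Subset n × List (Fin n) → List (Subset n × List (Fin n)) → List (Subset n × List (Fin n))
  keep (T , []) cs = cs
  keep (T , Q@(_ ∷ _)) cs = (T , Q) ∷ cs

  children : Subset n → List (Fin n) → Fin n → List (Subset n × List (Fin n))
  children S P x =
    if isBridge S P x then []
    else if isAncestor S P x
      then keep (VR S x , partIn (VR S x) P) (keep (VS S x , partIn (VS S x) P) [])
      else keep (VP S x , partIn (VP S x) P) (keep (VR S x , partIn (VR S x) P) [])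

  countV : (Fin n → Bool) → ℕ
  countV f = ∣ tabulate f ∣

  eta : Subset n → List (Fin n) → ℕ
  eta S P = countV (active S P)

  eta' : Subset n → List (Fin n) → List (Subset n × List (Fin n)) → ℕ
  eta' S₀ P₀ cs = countV (λ v → active S₀ P₀ v ∧ any (λ { (T , Q) → active T Q v }) cs)

  -- uniform average of f over the vertices of S (0 if S is empty)
  avg : Subset n → (Fin n → ℚ) → ℚ
  avg S f with ∣ S ∣
  ... | zero = 0ℚ
  ... | suc m = foldr (λ x acc → if memb S x then f x + acc else acc) 0ℚ (allFin n) * ((+ 1) / suc m)

  -- E[η'] for the flattened node starting at call (S₀ , P₀): repeatedly pick a
  -- uniform pivot in the current graph S; an unrelated pivot moves to G[V_R]
  -- with the same path; the first related pivot determines the children.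
  -- The fuel argument bounds the number of calls (n suffices).
  flatE : ℕ → Subset n → List (Fin n) → Subset n → List (Fin n) → ℚ
  flatE zero S₀ P₀ S P = 0ℚ
  flatE (suc k) S₀ P₀ S P =
    avg S (λ x → if related S P x
                   then (+ eta' S₀ P₀ (children S P x)) / 1
                   else flatE k S₀ P₀ (VR S x) P)

  expectedEta' : Subset n → List (Fin n) → ℚ
  expectedEta' S P = flatE n S P S P

-- Let η be the number of vertices related to P, α and δ the numbers of ancestors and descendants,
-- and I (`incidences`) the number of pairs (x , v) with x related and v path active in a child of pivot x.
-- A related pivot x contributes at most #{v : (x , v) counted in I}; an unrelated pivot passes the
-- same path to G[V_R], whose η is no larger, so by induction along the flattened node
-- |S| E[η'] < I + (|S| - η)(3/4)η, and it suffices that I < (3/4)η².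
-- Two related vertices can each lie in a child of the other's pivot only if one is an ancestor and
-- the other a descendant: a bridge pivot has no children, and two ancestors (or two descendants)
-- are excluded because the vertices of P are totally ordered by reachability.  Hence
-- 2I ≤ η² + 2αδ.  The vertices of P are bridges, so α + δ < η and 4I ≤ 2η² + (α + δ)² < 3η².

module Submission where

open import Defs
open import Data.Nat using (ℕ; zero; suc; z≤n; s≤s)
import Data.Nat as ℕ
import Data.Nat.Properties as ℕ
open import Data.Nat.Tactic.RingSolver using (solve-∀)
open import Data.Nat.Coprimality as Coprime using (1-coprimeTo)
open import Algebra.Properties.Semiring.Sum ℕ.+-*-semiring
  using (sum; sum-syntax; sum-cong-≗; ∑-distrib-+; ∑-comm; *-distribˡ-sum; *-distribʳ-sum)
open import Data.Bool using (Bool; true; false; _∧_; _∨_; not; if_then_else_; _≟_)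
open import Data.Bool.Properties using (∧-conicalˡ; ∧-conicalʳ; ∨-conicalˡ; ∨-conicalʳ; ∧-zeroʳ; ∧-identityʳ; T-≡)
open import Data.Bool.ListAction using (any)
open import Data.Fin using (Fin)
open import Data.Fin.Subset using (Subset; _∈_; _⊆_; ∣_∣; ∁; _∪_)
open import Data.Vec as Vec using (lookup)
open import Data.Vec.Properties using ([]=⇒lookup; lookup⇒[]=; lookup∘tabulate; lookup-zipWith; lookup-map; tabulate∘lookup)
open import Data.List as List using (List; []; _∷_; foldr; allFin)
open import Data.List.Membership.Propositional using (find; lose) renaming (_∈_ to _∈ₗ_)
open import Data.List.Membership.Propositional.Properties using (∈-filter⁻)
open import Data.List.Relation.Unary.Any using (here; there)
open import Data.List.Relation.Unary.Any.Properties using (any⁺; any⁻)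
import Data.Integer as ℤ
import Data.Integer.Properties as ℤ
open import Data.Rational using (ℚ; 0ℚ; 1ℚ; mkℚ)
import Data.Rational as ℚ
import Data.Rational.Properties as ℚ
open import Data.Rational.Solver using (module +-*-Solver)
open import Data.Product using (_×_; _,_; proj₁; proj₂; ∃-syntax)
open import Data.Sum as Sum using (_⊎_; inj₁; inj₂)
open import Data.Empty using (⊥; ⊥-elim)
open import Function using (id; _∘_; Equivalence)
open import Relation.Nullary using (yes; no; contradiction)
open import Relation.Nullary.Decidable using (dec-true)
open import Relation.Binary.PropositionalEquality using (_≡_; refl; sym; trans; cong; cong₂; subst; subst₂; module ≡-Reasoning)

module Counting where
  open import Data.Nat using (_+_; _*_; _≤_; _<_)

  contradictionᵇ : ∀ {A : Set} {b : Bool} → b ≡ true → b ≡ false → A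
  contradictionᵇ refl ()

  ∧-true : ∀ {a b} → a ≡ true → b ≡ true → a ∧ b ≡ true
  ∧-true refl refl = refl

  ∨-true⁻ : ∀ a {b} → a ∨ b ≡ true → a ≡ true ⊎ b ≡ true
  ∨-true⁻ true _ = inj₁ refl
  ∨-true⁻ false b≡true = inj₂ b≡true

  ∨-trueˡ : ∀ {a} b → a ≡ true → a ∨ b ≡ true
  ∨-trueˡ _ refl = refl

  ∨-trueʳ : ∀ a {b} → b ≡ true → a ∨ b ≡ true
  ∨-trueʳ true _ = refl
  ∨-trueʳ false b≡true = b≡true

  any-true⁻ : ∀ {A : Set} (p : A → Bool) xs → any p xs ≡ true → ∃[ x ] x ∈ₗ xs × p x ≡ true
  any-true⁻ p xs any≡true with find (any⁻ p xs (Equivalence.from T-≡ any≡true))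
  ... | x , x∈xs , px = x , x∈xs , Equivalence.to T-≡ px

  any-true⁺ : ∀ {A : Set} (p : A → Bool) {xs x} → x ∈ₗ xs → p x ≡ true → any p xs ≡ true
  any-true⁺ p x∈xs px = Equivalence.to T-≡ (any⁺ p (lose x∈xs (Equivalence.from T-≡ px)))

  any-false : ∀ {A : Set} (p : A → Bool) {xs x} → x ∈ₗ xs → any p xs ≡ false → p x ≡ false
  any-false p {x = x} x∈xs any≡false with p x in px
  ... | false = refl
  ... | true = contradictionᵇ (any-true⁺ p x∈xs px) any≡false

  not-true : ∀ {a} → not a ≡ true → a ≡ false
  not-true {false} _ = refl

  one-sided : ∀ a b → b ∧ a ≡ false → a ∨ b ≡ true →
    (a ∧ not b ≡ true × b ∧ not a ≡ false) ⊎ (a ∧ not b ≡ false × b ∧ not a ≡ true)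
  one-sided true false _ _ = inj₁ (refl , refl)
  one-sided false true _ _ = inj₂ (refl , refl)

  𝟙 : Bool → ℕ
  𝟙 true = 1
  𝟙 false = 0

  𝟙-∧ : ∀ a b → 𝟙 (a ∧ b) ≡ 𝟙 a * 𝟙 b
  𝟙-∧ true b = sym (ℕ.+-identityʳ (𝟙 b))
  𝟙-∧ false b = refl

  𝟙-∨ : ∀ a b → 𝟙 (a ∨ b) ≤ 𝟙 a + 𝟙 b
  𝟙-∨ true b = s≤s z≤n
  𝟙-∨ false b = ℕ.≤-refl

  𝟙-mono : ∀ {a b} → (a ≡ true → b ≡ true) → 𝟙 a ≤ 𝟙 b
  𝟙-mono {false} _ = z≤n
  𝟙-mono {true} a⇒b rewrite a⇒b refl = ℕ.≤-refl

  𝟙-split : ∀ a b → 𝟙 (a ∧ not b) + 𝟙 (a ∧ b) ≡ 𝟙 a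
  𝟙-split true true = refl
  𝟙-split true false = refl
  𝟙-split false b = refl

  𝟙-one-sided≤𝟙-∨ : ∀ a b → 𝟙 (a ∧ not b) + 𝟙 (b ∧ not a) ≤ 𝟙 (a ∨ b)
  𝟙-one-sided≤𝟙-∨ true true = z≤n
  𝟙-one-sided≤𝟙-∨ true false = ℕ.≤-refl
  𝟙-one-sided≤𝟙-∨ false true = ℕ.≤-refl
  𝟙-one-sided≤𝟙-∨ false false = z≤n

  𝟙-one-sided<𝟙-∨ : ∀ a b → b ∧ a ≡ true → 𝟙 (a ∧ not b) + 𝟙 (b ∧ not a) < 𝟙 (a ∨ b)
  𝟙-one-sided<𝟙-∨ true true _ = s≤s z≤n

  𝟙-pair : ∀ {p c q d e} → (c ≡ true → q ≡ true) → (d ≡ true → p ≡ true) → (c ≡ true → d ≡ true → e ≡ true) →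
    𝟙 (p ∧ c) + 𝟙 (q ∧ d) ≤ 𝟙 (p ∧ q) + 𝟙 e
  𝟙-pair {false} {_} {_} {true} _ d⇒p _ = contradiction (d⇒p refl) λ ()
  𝟙-pair {_} {true} {false} {_} c⇒q _ _ = contradiction (c⇒q refl) λ ()
  𝟙-pair {false} {_} {false} {false} _ _ _ = z≤n
  𝟙-pair {false} {_} {true} {false} _ _ _ = z≤n
  𝟙-pair {true} {false} {false} {false} _ _ _ = z≤n
  𝟙-pair {true} {false} {false} {true} _ _ _ = z≤n
  𝟙-pair {true} {false} {true} {false} _ _ _ = z≤n
  𝟙-pair {true} {false} {true} {true} _ _ _ = s≤s z≤n
  𝟙-pair {true} {true} {true} {false} _ _ _ = s≤s z≤n
  𝟙-pair {true} {true} {true} {true} _ _ c⇒d⇒e rewrite c⇒d⇒e refl refl = ℕ.≤-refl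

  ∑-mono-≤ : ∀ {m} {f g : Fin m → ℕ} → (∀ i → f i ≤ g i) → sum f ≤ sum g
  ∑-mono-≤ {zero} f≤g = z≤n
  ∑-mono-≤ {suc m} f≤g = ℕ.+-mono-≤ (f≤g Fin.zero) (∑-mono-≤ (f≤g ∘ Fin.suc))

  ∑-mono-< : ∀ {m} {f g : Fin m → ℕ} → (∀ i → f i ≤ g i) → ∀ j → f j < g j → sum f < sum g
  ∑-mono-< f≤g Fin.zero fj<gj = ℕ.+-mono-<-≤ fj<gj (∑-mono-≤ (f≤g ∘ Fin.suc))
  ∑-mono-< f≤g (Fin.suc j) fj<gj = ℕ.+-mono-≤-< (f≤g Fin.zero) (∑-mono-< (f≤g ∘ Fin.suc) j fj<gj)

  ∑-distrib-+₃ : ∀ {m} (f g h : Fin m → ℕ) → ∑[ i < m ] (f i + (g i + h i)) ≡ sum f + (sum g + sum h)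
  ∑-distrib-+₃ f g h = trans (∑-distrib-+ f (λ i → g i + h i)) (cong (sum f +_) (∑-distrib-+ g h))

  ∑-product : ∀ {m k} (f : Fin m → ℕ) (g : Fin k → ℕ) →
    ∑[ i < m ] ∑[ j < k ] (f i * g j) ≡ sum f * sum g
  ∑-product f g = trans (sum-cong-≗ (λ i → sym (*-distribˡ-sum (f i) g))) (sym (*-distribʳ-sum (sum g) f))

  count-tabulate : ∀ {m} (f : Fin m → Bool) → ∣ Vec.tabulate f ∣ ≡ ∑[ i < m ] 𝟙 (f i)
  count-tabulate {zero} f = refl
  count-tabulate {suc m} f with f Fin.zero
  ... | true = cong suc (count-tabulate (f ∘ Fin.suc))
  ... | false = count-tabulate (f ∘ Fin.suc)

  size-∑ : ∀ {m} (S : Subset m) → ∣ S ∣ ≡ ∑[ i < m ] 𝟙 (lookup S i)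
  size-∑ S = trans (cong ∣_∣ (sym (tabulate∘lookup S))) (count-tabulate (lookup S))

  am-gm-ordered : ∀ {m n} → m ≤ n → 4 * (m * n) ≤ (m + n) * (m + n)
  am-gm-ordered {m} m≤n with ℕ.m≤n⇒∃[o]m+o≡n m≤n
  ... | e , refl = subst (4 * (m * (m + e)) ≤_) (expand m e) (ℕ.m≤m+n _ (e * e))
    where
    expand : ∀ m e → 4 * (m * (m + e)) + e * e ≡ (m + (m + e)) * (m + (m + e))
    expand = solve-∀

  am-gm : ∀ m n → 4 * (m * n) ≤ (m + n) * (m + n)
  am-gm m n with ℕ.≤-total m n
  ... | inj₁ m≤n = am-gm-ordered m≤n
  ... | inj₂ n≤m = subst₂ _≤_ (cong (4 *_) (ℕ.*-comm n m)) (cong (λ s → s * s) (ℕ.+-comm n m)) (am-gm-ordered n≤m)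

  4t<3a² : ∀ t a α δ → 2 * t ≤ a * a + (α * δ + δ * α) → α + δ < a → 4 * t < 3 * (a * a)
  4t<3a² t a α δ 2t≤ α+δ<a = begin-strict
    4 * t                              ≡⟨ ℕ.*-assoc 2 2 t ⟩
    2 * (2 * t)                        ≤⟨ ℕ.*-monoʳ-≤ 2 2t≤ ⟩
    2 * (a * a + (α * δ + δ * α))      ≡⟨ regroup a α δ ⟩
    2 * (a * a) + 4 * (α * δ)          ≤⟨ ℕ.+-monoʳ-≤ (2 * (a * a)) (am-gm α δ) ⟩
    2 * (a * a) + (α + δ) * (α + δ)    <⟨ ℕ.+-monoʳ-< (2 * (a * a)) (ℕ.*-mono-< α+δ<a α+δ<a) ⟩
    2 * (a * a) + a * a                ≡⟨ ℕ.+-comm (2 * (a * a)) (a * a) ⟩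
    3 * (a * a)                        ∎
    where
    open ℕ.≤-Reasoning
    regroup : ∀ a α δ → 2 * (a * a + (α * δ + δ * α)) ≡ 2 * (a * a) + 4 * (α * δ)
    regroup = solve-∀

module Embedding where
  open import Data.Integer using (+_)
  open import Data.Rational using (_/_; _+_; _*_; _≤_; _<_)

  ι : ℕ → ℚ
  ι m = + m / 1

  ι-mkℚ : ∀ m → ι m ≡ mkℚ (+ m) 0 (Coprime.sym (1-coprimeTo m))
  ι-mkℚ m = ℚ.normalize-coprime (Coprime.sym (1-coprimeTo m))

  ι-+ : ∀ a b → ι (a ℕ.+ b) ≡ ι a + ι b
  ι-+ a b rewrite ι-mkℚ a | ι-mkℚ b = cong (_/ 1) (sym (cong₂ ℤ._+_ (ℤ.*-identityʳ (+ a)) (ℤ.*-identityʳ (+ b))))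

  ι-* : ∀ a b → ι (a ℕ.* b) ≡ ι a * ι b
  ι-* a b rewrite ι-mkℚ a | ι-mkℚ b = cong (_/ 1) (ℤ.pos-* a b)

  ι-≤ : ∀ {a b} → a ℕ.≤ b → ι a ≤ ι b
  ι-≤ {a} {b} a≤b rewrite ι-mkℚ a | ι-mkℚ b =
    ℚ.*≤* (subst₂ ℤ._≤_ (sym (ℤ.*-identityʳ (+ a))) (sym (ℤ.*-identityʳ (+ b))) (ℤ.+≤+ a≤b))

  ι-< : ∀ {a b} → a ℕ.< b → ι a < ι b
  ι-< {a} {b} a<b rewrite ι-mkℚ a | ι-mkℚ b =
    ℚ.*<* (subst₂ ℤ._<_ (sym (ℤ.*-identityʳ (+ a))) (sym (ℤ.*-identityʳ (+ b))) (ℤ.+<+ a<b))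

  ι-nonNeg : ∀ m → 0ℚ ≤ ι m
  ι-nonNeg m = ι-≤ {0} {m} z≤n

  ι-suc-inverse : ∀ m → ι (suc m) * (+ 1 / suc m) ≡ 1ℚ
  ι-suc-inverse m rewrite ι-mkℚ (suc m) | ℚ.normalize-coprime {1} {m} (1-coprimeTo (suc m)) =
    ℚ.*-inverseʳ (mkℚ (+ suc m) 0 (Coprime.sym (1-coprimeTo (suc m))))

  ¾ : ℚ
  ¾ = + 3 / 4

  ι<¾*ι*ι : ∀ {a b} → 4 ℕ.* a ℕ.< 3 ℕ.* (b ℕ.* b) → ι a < ¾ * ι b * ι b
  -- ¼ * ι 4 computes to 1ℚ and ι 3 * ¼ to ¾.
  ι<¾*ι*ι {a} {b} 4a<3b² = begin-strict
    ι a                          ≡⟨ sym (ℚ.*-identityˡ (ι a)) ⟩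
    (¼ * ι 4) * ι a              ≡⟨ ℚ.*-assoc ¼ (ι 4) (ι a) ⟩
    ¼ * (ι 4 * ι a)              ≡⟨ cong (¼ *_) (sym (ι-* 4 a)) ⟩
    ¼ * ι (4 ℕ.* a)              <⟨ ℚ.*-monoʳ-<-pos ¼ (ι-< 4a<3b²) ⟩
    ¼ * ι (3 ℕ.* (b ℕ.* b))      ≡⟨ cong (¼ *_) (trans (ι-* 3 (b ℕ.* b)) (cong (ι 3 *_) (ι-* b b))) ⟩
    ¼ * (ι 3 * (ι b * ι b))      ≡⟨ regroup ¼ (ι 3) (ι b) ⟩
    ι 3 * ¼ * ι b * ι b          ∎
    where
    open ℚ.≤-Reasoning
    open +-*-Solver
    ¼ : ℚ
    ¼ = + 1 / 4
    regroup : ∀ q t x → q * (t * (x * x)) ≡ t * q * x * x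
    regroup = solve 3 (λ q t x → q :* (t :* (x :* x)) := t :* q :* x :* x) refl

  ι-+-regroup : ∀ a a′ b b′ c → ι (a ℕ.+ a′) + c * ι (b ℕ.+ b′) ≡ (ι a + c * ι b) + (ι a′ + c * ι b′)
  ι-+-regroup a a′ b b′ c rewrite ι-+ a a′ | ι-+ b b′ = shuffle (ι a) (ι a′) c (ι b) (ι b′)
    where
    open +-*-Solver
    shuffle : ∀ a a′ c b b′ → (a + a′) + c * (b + b′) ≡ (a + c * b) + (a′ + c * b′)
    shuffle = solve 5 (λ a a′ c b b′ → (a :+ a′) :+ c :* (b :+ b′) := (a :+ c :* b) :+ (a′ :+ c :* b′)) refl

  sumOver : ∀ {n} → Subset n → (Fin n → ℚ) → ℚ
  sumOver {n} S f = foldr (λ x acc → if lookup S x then f x + acc else acc) 0ℚ (allFin n)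

  sumOver-≤ : ∀ {n} (S : Subset n) (f : Fin n → ℚ) (u v : Fin n → ℕ) {c : ℚ} → 0ℚ ≤ c →
    (∀ x → lookup S x ≡ true → f x ≤ ι (u x) + c * ι (v x)) → sumOver S f ≤ ι (sum u) + c * ι (sum v)
  sumOver-≤ {n} S f u v {c} 0≤c f≤ = over id
    where
    add : Fin n → ℚ → ℚ
    add x acc = if lookup S x then f x + acc else acc
    over : ∀ {m} (h : Fin m → Fin n) → foldr add 0ℚ (List.tabulate h) ≤ ι (sum (u ∘ h)) + c * ι (sum (v ∘ h))
    over {zero} h = ℚ.≤-reflexive (sym (trans (cong (λ z → 0ℚ + z) (ℚ.*-zeroʳ c)) (ℚ.+-identityʳ 0ℚ)))
    over {suc m} h with lookup S (h Fin.zero) in x∈S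
    ... | true = ℚ.≤-trans (ℚ.+-mono-≤ (f≤ (h Fin.zero) x∈S) (over (h ∘ Fin.suc)))
      (ℚ.≤-reflexive (sym (ι-+-regroup (u (h Fin.zero)) (sum (u ∘ h ∘ Fin.suc)) (v (h Fin.zero)) (sum (v ∘ h ∘ Fin.suc)) c)))
    ... | false = ℚ.≤-trans (over (h ∘ Fin.suc))
      (ℚ.+-mono-≤ (ι-≤ (ℕ.m≤n+m (sum (u ∘ h ∘ Fin.suc)) (u (h Fin.zero))))
                  (ℚ.*-monoˡ-≤-nonNeg c {{ℚ.nonNegative 0≤c}} (ι-≤ (ℕ.m≤n+m (sum (v ∘ h ∘ Fin.suc)) (v (h Fin.zero))))))

module Pivots {n : ℕ} (E : Graph n) (dec : ReachDec E) where
  open Procedure E dec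
  open Counting
  open import Data.Nat using (_+_; _*_; _≤_; _<_)

  lookup⇒∈ : ∀ {S : Subset n} {v} → lookup S v ≡ true → v ∈ S
  lookup⇒∈ = lookup⇒[]= _ _

  Reach-mono : ∀ {T S u v} → T ⊆ S → Reach E T u v → Reach E S u v
  Reach-mono T⊆S (here u∈T) = here (T⊆S u∈T)
  Reach-mono T⊆S (step u∈T uv r) = step (T⊆S u∈T) uv (Reach-mono T⊆S r)

  Reach-trans : ∀ {S u v w} → Reach E S u v → Reach E S v w → Reach E S u w
  Reach-trans (here _) r = r
  Reach-trans (step u∈S uv r) r′ = step u∈S uv (Reach-trans r r′)

  Reach-source : ∀ {S u v} → Reach E S u v → u ∈ S
  Reach-source (here u∈S) = u∈S
  Reach-source (step u∈S _ _) = u∈S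

  Reach-target : ∀ {S u v} → Reach E S u v → v ∈ S
  Reach-target (here v∈S) = v∈S
  Reach-target (step _ _ r) = Reach-target r

  reach-sound : ∀ {S u v} → reach S u v ≡ true → Reach E S u v
  reach-sound {S} {u} {v} reach≡true with dec S u v
  ... | yes r = r
  ... | no _ = contradiction reach≡true λ ()

  reach-complete : ∀ {S u v} → Reach E S u v → reach S u v ≡ true
  reach-complete {S} {u} {v} = dec-true (dec S u v)

  Comparable : Subset n → Fin n → Fin n → Set
  Comparable S u v = Reach E S u v ⊎ Reach E S v u

  path-head-reaches : ∀ {S u P q} → Consecutive E (u ∷ P) → AllIn S (u ∷ P) → q ∈ₗ u ∷ P → Reach E S u q
  path-head-reaches _ (u∈S ∷ _) (here refl) = here u∈S
  path-head-reaches (uv ∷ c) (u∈S ∷ a) (there q∈P) = step u∈S uv (path-head-reaches c a q∈P)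

  path-comparable : ∀ {S P q q′} → Consecutive E P → AllIn S P → q ∈ₗ P → q′ ∈ₗ P → Comparable S q q′
  path-comparable c a (here refl) q′∈ = inj₁ (path-head-reaches c a q′∈)
  path-comparable c a (there q∈) (here refl) = inj₂ (path-head-reaches c a (there q∈))
  path-comparable [-] _ (there ()) (there _)
  path-comparable (_ ∷ c) (_ ∷ a) (there q∈) (there q′∈) = path-comparable c a q∈ q′∈

  related⁻ : ∀ {S P y} → related S P y ≡ true → ∃[ q ] q ∈ₗ P × Comparable S y q
  related⁻ {S} {P} {y} rel with ∨-true⁻ (reachesP S P y) rel
  ... | inj₁ y⪯P with any-true⁻ (reach S y) P y⪯P
  ...   | q , q∈P , y⪯q = q , q∈P , inj₁ (reach-sound y⪯q)
  related⁻ {S} {P} {y} rel | inj₂ P⪯y with any-true⁻ (λ q → reach S q y) P P⪯y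
  ...   | q , q∈P , q⪯y = q , q∈P , inj₂ (reach-sound q⪯y)

  related⁺ : ∀ {S P y q} → q ∈ₗ P → Comparable S y q → related S P y ≡ true
  related⁺ {S} {P} {y} q∈P (inj₁ y⪯q) = ∨-trueˡ _ (any-true⁺ (reach S y) q∈P (reach-complete y⪯q))
  related⁺ {S} {P} {y} q∈P (inj₂ q⪯y) = ∨-trueʳ (reachesP S P y) (any-true⁺ (λ q → reach S q y) q∈P (reach-complete q⪯y))

  related⇒∈ : ∀ {S P y} → related S P y ≡ true → y ∈ S
  related⇒∈ {S} {P} rel with related⁻ {S} {P} rel
  ... | _ , _ , inj₁ y⪯q = Reach-source y⪯q
  ... | _ , _ , inj₂ q⪯y = Reach-target q⪯y

  AllIn⇒∈ : ∀ {S : Subset n} {P q} → AllIn S P → q ∈ₗ P → q ∈ S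
  AllIn⇒∈ (q∈S ∷ _) (here refl) = q∈S
  AllIn⇒∈ (_ ∷ a) (there q∈P) = AllIn⇒∈ a q∈P

  path-vertex-isBridge : ∀ {S P q} → AllIn S P → q ∈ₗ P → isBridge S P q ≡ true
  path-vertex-isBridge {S} {P} {q} a q∈P = ∧-true
    (any-true⁺ (λ w → reach S w q) q∈P (reach-complete (here (AllIn⇒∈ a q∈P))))
    (any-true⁺ (reach S q) q∈P (reach-complete (here (AllIn⇒∈ a q∈P))))

  countV-mono : ∀ {f g} → (∀ v → f v ≡ true → g v ≡ true) → countV f ≤ countV g
  countV-mono {f} {g} f⇒g rewrite count-tabulate f | count-tabulate g = ∑-mono-≤ (λ v → 𝟙-mono (f⇒g v))

  path-vertex : ∀ {S} P → IsPath E S P → ∃[ p ] p ∈ₗ P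
  path-vertex [] path = contradiction refl (IsPath.nonempty path)
  path-vertex (p ∷ _) _ = p , here refl

  lookup-VS : ∀ S x v → lookup (VS S x) v ≡ reach S x v ∧ not (reach S x v ∧ reach S v x)
  lookup-VS S x v
    rewrite lookup-zipWith _∧_ v (R⁺ S x) (∁ (VB S x))
          | lookup-map v not (VB S x)
          | lookup-zipWith _∧_ v (R⁺ S x) (R⁻ S x)
          | lookup∘tabulate (reach S x) v
          | lookup∘tabulate (λ u → reach S u x) v = refl

  lookup-VP : ∀ S x v → lookup (VP S x) v ≡ reach S v x ∧ not (reach S x v ∧ reach S v x)
  lookup-VP S x v
    rewrite lookup-zipWith _∧_ v (R⁻ S x) (∁ (VB S x))
          | lookup-map v not (VB S x)
          | lookup-zipWith _∧_ v (R⁺ S x) (R⁻ S x)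
          | lookup∘tabulate (reach S x) v
          | lookup∘tabulate (λ u → reach S u x) v = refl

  lookup-VR : ∀ S x v → lookup (VR S x) v ≡ lookup S v ∧ not (reach S x v ∨ reach S v x)
  lookup-VR S x v
    rewrite lookup-zipWith _∧_ v S (∁ (R⁺ S x ∪ R⁻ S x))
          | lookup-map v not (R⁺ S x ∪ R⁻ S x)
          | lookup-zipWith _∨_ v (R⁺ S x) (R⁻ S x)
          | lookup∘tabulate (reach S x) v
          | lookup∘tabulate (λ u → reach S u x) v = refl

  VS-reach : ∀ {S x v} → lookup (VS S x) v ≡ true → reach S x v ≡ true × reach S v x ≡ false
  VS-reach {S} {x} {v} v∈ rewrite lookup-VS S x v with reach S x v | reach S v x
  ... | true | false = refl , refl

  VP-reach : ∀ {S x v} → lookup (VP S x) v ≡ true → reach S v x ≡ true × reach S x v ≡ false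
  VP-reach {S} {x} {v} v∈ rewrite lookup-VP S x v with reach S x v | reach S v x
  ... | false | true = refl , refl

  VR-reach : ∀ {S x v} → lookup (VR S x) v ≡ true → lookup S v ≡ true × reach S x v ≡ false × reach S v x ≡ false
  VR-reach {S} {x} {v} v∈ rewrite lookup-VR S x v with lookup S v | reach S x v | reach S v x
  ... | true | false | false = refl , refl , refl

  VR-intro : ∀ {S x v} → lookup S v ≡ true → reach S x v ≡ false → reach S v x ≡ false → lookup (VR S x) v ≡ true
  VR-intro {S} {x} {v} v∈S x⋠v v⋠x rewrite lookup-VR S x v | v∈S | x⋠v | v⋠x = refl

  VS⊆ : ∀ {S x} → VS S x ⊆ S
  VS⊆ {S} {x} v∈ = Reach-target (reach-sound (proj₁ (VS-reach {S} {x} ([]=⇒lookup v∈))))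

  VP⊆ : ∀ {S x} → VP S x ⊆ S
  VP⊆ {S} {x} v∈ = Reach-source (reach-sound (proj₁ (VP-reach {S} {x} ([]=⇒lookup v∈))))

  VR⊆ : ∀ {S x} → VR S x ⊆ S
  VR⊆ {S} {x} v∈ = lookup⇒∈ (proj₁ (VR-reach {S} {x} ([]=⇒lookup v∈)))

  activeIn : Subset n → List (Fin n) → Fin n → Bool
  activeIn T P v = active T (partIn T P) v

  activeIn⁻ : ∀ {S T P v} → T ⊆ S → activeIn T P v ≡ true →
    lookup T v ≡ true × ∃[ q ] q ∈ₗ P × lookup T q ≡ true × Comparable S v q
  activeIn⁻ {S} {T} {P} {v} T⊆S act with related⁻ {T} {partIn T P} (∧-conicalʳ (lookup T v) _ act)
  ... | q , q∈part , v~q with ∈-filter⁻ (λ w → lookup T w ≟ true) q∈part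
  ...   | q∈P , q∈T = ∧-conicalˡ _ _ act , q , q∈P , q∈T , Sum.map (Reach-mono T⊆S) (Reach-mono T⊆S) v~q

  inChild : Subset n → List (Fin n) → Fin n → Fin n → Bool
  inChild S P x v = any (λ c → active (proj₁ c) (proj₂ c) v) (children S P x)

  data ChildOf (S : Subset n) (P : List (Fin n)) (x v : Fin n) : Set where
    in-VR : activeIn (VR S x) P v ≡ true → ChildOf S P x v
    in-VS : isAncestor S P x ≡ true → activeIn (VS S x) P v ≡ true → ChildOf S P x v
    in-VP : isAncestor S P x ≡ false → activeIn (VP S x) P v ≡ true → ChildOf S P x v

  inChild⁻ : ∀ {S P x v} → inChild S P x v ≡ true → isBridge S P x ≡ false × ChildOf S P x v
  inChild⁻ {S} {P} {x} {v} = cases (isBridge S P x) (isAncestor S P x) refl refl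
    where
    activeᶜ : Subset n × List (Fin n) → Bool
    activeᶜ c = active (proj₁ c) (proj₂ c) v
    any-keep : ∀ T Q cs → any activeᶜ (keep (T , Q) cs) ≡ true → active T Q v ≡ true ⊎ any activeᶜ cs ≡ true
    any-keep T [] _ in-cs = inj₂ in-cs
    any-keep T (_ ∷ _) _ in-keep = ∨-true⁻ _ in-keep
    cases : ∀ b a → isBridge S P x ≡ b → isAncestor S P x ≡ a →
      any activeᶜ (if b then [] else if a
        then keep (VR S x , partIn (VR S x) P) (keep (VS S x , partIn (VS S x) P) [])
        else keep (VP S x , partIn (VP S x) P) (keep (VR S x , partIn (VR S x) P) [])) ≡ true →
      isBridge S P x ≡ false × ChildOf S P x v
    cases false true ¬bridge anc in-children with any-keep (VR S x) (partIn (VR S x) P) _ in-children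
    ... | inj₁ act = ¬bridge , in-VR act
    ... | inj₂ in-rest with any-keep (VS S x) (partIn (VS S x) P) [] in-rest
    ...   | inj₁ act = ¬bridge , in-VS anc act
    cases false false ¬bridge ¬anc in-children with any-keep (VP S x) (partIn (VP S x) P) _ in-children
    ... | inj₁ act = ¬bridge , in-VP ¬anc act
    ... | inj₂ in-rest with any-keep (VR S x) (partIn (VR S x) P) [] in-rest
    ...   | inj₁ act = ¬bridge , in-VR act

  activeIn⇒related : ∀ {S T P v} → T ⊆ S → activeIn T P v ≡ true → related S P v ≡ true
  activeIn⇒related {S} {T} {P} T⊆S act with activeIn⁻ {S} {T} {P} T⊆S act
  ... | _ , q , q∈P , _ , v~q = related⁺ q∈P v~q

  inChild⇒related : ∀ {S P x v} → inChild S P x v ≡ true → related S P v ≡ true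
  inChild⇒related {S} {P} {x} in-child with proj₂ (inChild⁻ {S} {P} {x} in-child)
  ... | in-VR act = activeIn⇒related {T = VR S x} {P = P} VR⊆ act
  ... | in-VS _ act = activeIn⇒related {T = VS S x} {P = P} VS⊆ act
  ... | in-VP _ act = activeIn⇒related {T = VP S x} {P = P} VP⊆ act

  eta-VR≤eta : ∀ S P x → eta (VR S x) P ≤ eta S P
  eta-VR≤eta S P x = countV-mono active-VR⇒active
    where
    active-VR⇒active : ∀ v → active (VR S x) P v ≡ true → active S P v ≡ true
    active-VR⇒active v act with related⁻ {VR S x} {P} (∧-conicalʳ (lookup (VR S x) v) _ act)
    ... | q , q∈P , v~q = ∧-true (proj₁ (VR-reach {S} {x} (∧-conicalˡ _ _ act)))
                                  (related⁺ q∈P (Sum.map (Reach-mono (VR⊆ {S} {x})) (Reach-mono VR⊆) v~q))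

  unrelated+eta≡size : ∀ S P → ∑[ x < n ] 𝟙 (lookup S x ∧ not (related S P x)) + eta S P ≡ ∣ S ∣
  unrelated+eta≡size S P = begin
    sum unrelated + eta S P                     ≡⟨ cong (sum unrelated +_) (count-tabulate (active S P)) ⟩
    sum unrelated + ∑[ x < n ] 𝟙 (active S P x) ≡⟨ sym (∑-distrib-+ unrelated (λ x → 𝟙 (active S P x))) ⟩
    ∑[ x < n ] (unrelated x + 𝟙 (active S P x)) ≡⟨ sum-cong-≗ (λ x → 𝟙-split (lookup S x) (related S P x)) ⟩
    ∑[ x < n ] 𝟙 (lookup S x)                   ≡⟨ sym (size-∑ S) ⟩
    ∣ S ∣                                       ∎
    where
    open ≡-Reasoning
    unrelated : Fin n → ℕ
    unrelated x = 𝟙 (lookup S x ∧ not (related S P x))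

  IsPath-VR : ∀ {S P x} → IsPath E S P → related S P x ≡ false → IsPath E (VR S x) P
  IsPath-VR {S} {P} {x} path unrelated = record
    { nonempty = IsPath.nonempty path
    ; consecutive = IsPath.consecutive path
    ; inS = inVR (IsPath.inS path) id
    ; distinct = IsPath.distinct path
    }
    where
    inVR : ∀ {Q} → AllIn S Q → (∀ {q} → q ∈ₗ Q → q ∈ₗ P) → AllIn (VR S x) Q
    inVR [] _ = []
    inVR {q ∷ _} (q∈S ∷ a) Q⊆P = lookup⇒∈ (VR-intro ([]=⇒lookup q∈S) x⋠q q⋠x) ∷ inVR a (Q⊆P ∘ there)
      where
      x⋠q : reach S x q ≡ false
      x⋠q = any-false (reach S x) (Q⊆P (here refl)) (∨-conicalˡ (reachesP S P x) _ unrelated)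
      q⋠x : reach S q x ≡ false
      q⋠x = any-false (λ w → reach S w x) (Q⊆P (here refl)) (∨-conicalʳ (reachesP S P x) _ unrelated)

  module _ (S : Subset n) (P : List (Fin n)) where

    relatedCount ancestorCount descendantCount incidences : ℕ
    relatedCount = ∑[ x < n ] 𝟙 (related S P x)
    ancestorCount = ∑[ x < n ] 𝟙 (isAncestor S P x)
    descendantCount = ∑[ x < n ] 𝟙 (isDescendant S P x)
    incidences = ∑[ x < n ] ∑[ v < n ] 𝟙 (related S P x ∧ inChild S P x v)

    eta≡relatedCount : eta S P ≡ relatedCount
    eta≡relatedCount = trans (count-tabulate (active S P)) (sum-cong-≗ active≡related)
      where
      active≡related : ∀ x → 𝟙 (active S P x) ≡ 𝟙 (related S P x)
      active≡related x with related S P x in rel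
      ... | true rewrite []=⇒lookup (related⇒∈ {S} {P} rel) = refl
      ... | false = cong 𝟙 (∧-zeroʳ (lookup S x))

    ancestors+descendants<related : ∀ {p} → AllIn S P → p ∈ₗ P → ancestorCount + descendantCount < relatedCount
    ancestors+descendants<related {p} inS p∈P =
      subst (_< relatedCount) (∑-distrib-+ (λ x → 𝟙 (isAncestor S P x)) (λ x → 𝟙 (isDescendant S P x)))
        (∑-mono-< (λ x → 𝟙-one-sided≤𝟙-∨ (reachesP S P x) (reachedByP S P x)) p
          (𝟙-one-sided<𝟙-∨ (reachesP S P p) (reachedByP S P p) (path-vertex-isBridge inS p∈P)))

    ancestor-inChild : ∀ {x y} → isAncestor S P x ≡ true → isAncestor S P y ≡ true → inChild S P x y ≡ true →
      reach S y x ≡ false × (reach S x y ≡ true ⊎ ∃[ q ] q ∈ₗ P × reach S x q ≡ false × Reach E S y q)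
    ancestor-inChild {x} {y} x-anc y-anc in-child with proj₂ (inChild⁻ {S} {P} {x} in-child)
    ... | in-VS _ act = proj₂ x⪯y×y⋠x , inj₁ (proj₁ x⪯y×y⋠x)
      where
      x⪯y×y⋠x : reach S x y ≡ true × reach S y x ≡ false
      x⪯y×y⋠x = VS-reach {S} {x} (∧-conicalˡ _ _ act)
    ... | in-VP x-not-anc _ = contradictionᵇ x-anc x-not-anc
    ... | in-VR act with activeIn⁻ {S} {VR S x} {P} VR⊆ act
    ...   | y∈VR , q , q∈P , q∈VR , inj₁ y⪯q =
            proj₂ (proj₂ (VR-reach {S} {x} y∈VR)) , inj₂ (q , q∈P , proj₁ (proj₂ (VR-reach {S} {x} q∈VR)) , y⪯q)
    ...   | _ , q , q∈P , _ , inj₂ q⪯y =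
            contradictionᵇ (any-true⁺ (λ w → reach S w y) q∈P (reach-complete q⪯y)) (not-true (∧-conicalʳ _ _ y-anc))

    descendant-inChild : ∀ {x y} → isDescendant S P x ≡ true → isDescendant S P y ≡ true → inChild S P x y ≡ true →
      reach S x y ≡ false × (reach S y x ≡ true ⊎ ∃[ q ] q ∈ₗ P × reach S q x ≡ false × Reach E S q y)
    descendant-inChild {x} {y} x-desc y-desc in-child with proj₂ (inChild⁻ {S} {P} {x} in-child)
    ... | in-VP _ act = proj₂ y⪯x×x⋠y , inj₁ (proj₁ y⪯x×x⋠y)
      where
      y⪯x×x⋠y : reach S y x ≡ true × reach S x y ≡ false
      y⪯x×x⋠y = VP-reach {S} {x} (∧-conicalˡ _ _ act)
    ... | in-VS x-anc _ = contradictionᵇ (∧-conicalˡ (reachesP S P x) _ x-anc) (not-true (∧-conicalʳ (reachedByP S P x) _ x-desc))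
    ... | in-VR act with activeIn⁻ {S} {VR S x} {P} VR⊆ act
    ...   | y∈VR , q , q∈P , q∈VR , inj₂ q⪯y =
            proj₁ (proj₂ (VR-reach {S} {x} y∈VR)) , inj₂ (q , q∈P , proj₂ (proj₂ (VR-reach {S} {x} q∈VR)) , q⪯y)
    ...   | _ , q , q∈P , _ , inj₁ y⪯q =
            contradictionᵇ (any-true⁺ (reach S y) q∈P (reach-complete y⪯q)) (not-true (∧-conicalʳ _ _ y-desc))

    module _ (consecutive : Consecutive E P) (inS : AllIn S P) where

      -- When neither pivot has the other in V_S, the path witnesses q and q′ are comparable,
      -- and either order contradicts x ⋠ q or y ⋠ q′.
      ancestors-not-mutual : ∀ {x y} → isAncestor S P x ≡ true → isAncestor S P y ≡ true →
        inChild S P x y ≡ true → inChild S P y x ≡ true → ⊥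
      ancestors-not-mutual x-anc y-anc xy yx with ancestor-inChild x-anc y-anc xy | ancestor-inChild y-anc x-anc yx
      ... | _ , inj₁ x⪯y | x⋠y , _ = contradictionᵇ x⪯y x⋠y
      ... | y⋠x , _ | _ , inj₁ y⪯x = contradictionᵇ y⪯x y⋠x
      ... | _ , inj₂ (q , q∈P , x⋠q , y⪯q) | _ , inj₂ (q′ , q′∈P , y⋠q′ , x⪯q′)
            with path-comparable consecutive inS q∈P q′∈P
      ...   | inj₁ q⪯q′ = contradictionᵇ (reach-complete (Reach-trans y⪯q q⪯q′)) y⋠q′
      ...   | inj₂ q′⪯q = contradictionᵇ (reach-complete (Reach-trans x⪯q′ q′⪯q)) x⋠q

      descendants-not-mutual : ∀ {x y} → isDescendant S P x ≡ true → isDescendant S P y ≡ true →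
        inChild S P x y ≡ true → inChild S P y x ≡ true → ⊥
      descendants-not-mutual x-desc y-desc xy yx with descendant-inChild x-desc y-desc xy | descendant-inChild y-desc x-desc yx
      ... | _ , inj₁ y⪯x | y⋠x , _ = contradictionᵇ y⪯x y⋠x
      ... | x⋠y , _ | _ , inj₁ x⪯y = contradictionᵇ x⪯y x⋠y
      ... | _ , inj₂ (q , q∈P , q⋠x , q⪯y) | _ , inj₂ (q′ , q′∈P , q′⋠y , q′⪯x)
            with path-comparable consecutive inS q∈P q′∈P
      ...   | inj₁ q⪯q′ = contradictionᵇ (reach-complete (Reach-trans q⪯q′ q′⪯x)) q⋠x
      ...   | inj₂ q′⪯q = contradictionᵇ (reach-complete (Reach-trans q′⪯q q⪯y)) q′⋠y

      mutual-children-opposite : ∀ {x v} → inChild S P x v ≡ true → inChild S P v x ≡ true →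
        (isAncestor S P x ∧ isDescendant S P v) ∨ (isDescendant S P x ∧ isAncestor S P v) ≡ true
      mutual-children-opposite {x} {v} xv vx
        with one-sided (reachesP S P x) (reachedByP S P x) (proj₁ (inChild⁻ {S} {P} {x} xv)) (inChild⇒related {S} {P} {v} vx)
           | one-sided (reachesP S P v) (reachedByP S P v) (proj₁ (inChild⁻ {S} {P} {v} vx)) (inChild⇒related {S} {P} {x} xv)
      ... | inj₁ (x-anc , _) | inj₁ (v-anc , _) = ⊥-elim (ancestors-not-mutual x-anc v-anc xv vx)
      ... | inj₁ (x-anc , _) | inj₂ (_ , v-desc) = ∨-trueˡ _ (∧-true x-anc v-desc)
      ... | inj₂ (_ , x-desc) | inj₁ (v-anc , _) = ∨-trueʳ (isAncestor S P x ∧ isDescendant S P v) (∧-true x-desc v-anc)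
      ... | inj₂ (_ , x-desc) | inj₂ (_ , v-desc) = ⊥-elim (descendants-not-mutual x-desc v-desc xv vx)

      incidence-pair : ∀ x v →
        𝟙 (related S P x ∧ inChild S P x v) + 𝟙 (related S P v ∧ inChild S P v x) ≤
        𝟙 (related S P x) * 𝟙 (related S P v) +
        (𝟙 (isAncestor S P x) * 𝟙 (isDescendant S P v) + 𝟙 (isDescendant S P x) * 𝟙 (isAncestor S P v))
      incidence-pair x v = begin
        𝟙 (related S P x ∧ inChild S P x v) + 𝟙 (related S P v ∧ inChild S P v x)
          ≤⟨ 𝟙-pair (inChild⇒related {S} {P} {x}) (inChild⇒related {S} {P} {v}) mutual-children-opposite ⟩
        𝟙 (related S P x ∧ related S P v) + 𝟙 (ancestor-descendant ∨ descendant-ancestor)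
          ≤⟨ ℕ.+-monoʳ-≤ _ (𝟙-∨ ancestor-descendant descendant-ancestor) ⟩
        𝟙 (related S P x ∧ related S P v) + (𝟙 ancestor-descendant + 𝟙 descendant-ancestor)
          ≡⟨ cong₂ _+_ (𝟙-∧ (related S P x) (related S P v))
               (cong₂ _+_ (𝟙-∧ (isAncestor S P x) (isDescendant S P v)) (𝟙-∧ (isDescendant S P x) (isAncestor S P v))) ⟩
        𝟙 (related S P x) * 𝟙 (related S P v) +
        (𝟙 (isAncestor S P x) * 𝟙 (isDescendant S P v) + 𝟙 (isDescendant S P x) * 𝟙 (isAncestor S P v)) ∎
        where
        open ℕ.≤-Reasoning
        ancestor-descendant descendant-ancestor : Bool
        ancestor-descendant = isAncestor S P x ∧ isDescendant S P v
        descendant-ancestor = isDescendant S P x ∧ isAncestor S P v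

      double-incidences : 2 * incidences ≤ relatedCount * relatedCount + (ancestorCount * descendantCount + descendantCount * ancestorCount)
      double-incidences = begin
        2 * incidences                                 ≡⟨ cong (incidences +_) (ℕ.+-identityʳ incidences) ⟩
        incidences + incidences                        ≡⟨ cong (incidences +_) (∑-comm m) ⟩
        incidences + ∑[ x < n ] ∑[ v < n ] m v x      ≡⟨ sym (∑-distrib-+ (λ x → ∑[ v < n ] m x v) (λ x → ∑[ v < n ] m v x)) ⟩
        ∑[ x < n ] (∑[ v < n ] m x v + ∑[ v < n ] m v x)  ≡⟨ sum-cong-≗ (λ x → sym (∑-distrib-+ (m x) (λ v → m v x))) ⟩
        ∑[ x < n ] ∑[ v < n ] (m x v + m v x)          ≤⟨ ∑-mono-≤ (λ x → ∑-mono-≤ (incidence-pair x)) ⟩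
        ∑[ x < n ] ∑[ v < n ] (R x * R v + (A x * D v + D x * A v))
          ≡⟨ sum-cong-≗ (λ x → ∑-distrib-+₃ (λ v → R x * R v) (λ v → A x * D v) (λ v → D x * A v)) ⟩
        ∑[ x < n ] (∑[ v < n ] (R x * R v) + (∑[ v < n ] (A x * D v) + ∑[ v < n ] (D x * A v)))
          ≡⟨ ∑-distrib-+₃ (λ x → ∑[ v < n ] (R x * R v)) (λ x → ∑[ v < n ] (A x * D v)) (λ x → ∑[ v < n ] (D x * A v)) ⟩
        ∑[ x < n ] ∑[ v < n ] (R x * R v) + (∑[ x < n ] ∑[ v < n ] (A x * D v) + ∑[ x < n ] ∑[ v < n ] (D x * A v))
          ≡⟨ cong₂ _+_ (∑-product R R) (cong₂ _+_ (∑-product A D) (∑-product D A)) ⟩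
        relatedCount * relatedCount + (ancestorCount * descendantCount + descendantCount * ancestorCount) ∎
        where
        open ℕ.≤-Reasoning
        m : Fin n → Fin n → ℕ
        m x v = 𝟙 (related S P x ∧ inChild S P x v)
        R A D : Fin n → ℕ
        R x = 𝟙 (related S P x)
        A x = 𝟙 (isAncestor S P x)
        D x = 𝟙 (isDescendant S P x)

    module _ (path : IsPath E S P) where

      eta-positive : 0 < eta S P
      eta-positive with path-vertex P path
      ... | p , p∈P = subst (0 <_) (sym eta≡relatedCount)
        (ℕ.≤-<-trans z≤n (ancestors+descendants<related (IsPath.inS path) p∈P))

      incidences-bound : 4 * incidences < 3 * (eta S P * eta S P)
      incidences-bound with path-vertex P path
      ... | p , p∈P = subst (λ η → 4 * incidences < 3 * (η * η)) (sym eta≡relatedCount)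
        (4t<3a² incidences relatedCount ancestorCount descendantCount
          (double-incidences (IsPath.consecutive path) (IsPath.inS path))
          (ancestors+descendants<related (IsPath.inS path) p∈P))

module Expectation {n : ℕ} (E : Graph n) (dec : ReachDec E) where
  open Procedure E dec
  open Counting using (𝟙; 𝟙-mono; count-tabulate; ∑-mono-≤)
  open Pivots E dec
  open Embedding
  open import Data.Integer using (+_)
  open import Data.Rational using (_/_; _+_; _*_; _≤_; _<_)

  avg-< : ∀ S f {B} → 0ℚ < B → sumOver S f < B * ι ∣ S ∣ → avg S f < B
  avg-< S f {B} 0<B sum< with ∣ S ∣
  ... | zero = 0<B
  ... | suc m = begin-strict
    sumOver S f * (+ 1 / suc m)        <⟨ ℚ.*-monoˡ-<-pos (+ 1 / suc m) {{ℚ.normalize-pos 1 (suc m)}} sum< ⟩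
    B * ι (suc m) * (+ 1 / suc m)      ≡⟨ ℚ.*-assoc B (ι (suc m)) (+ 1 / suc m) ⟩
    B * (ι (suc m) * (+ 1 / suc m))    ≡⟨ cong (B *_) (ι-suc-inverse m) ⟩
    B * 1ℚ                             ≡⟨ ℚ.*-identityʳ B ⟩
    B                                  ∎
    where open ℚ.≤-Reasoning

  bound : Subset n → List (Fin n) → ℚ
  bound S P = ¾ * ι (eta S P)

  bound-positive : ∀ {S P} → IsPath E S P → 0ℚ < bound S P
  bound-positive {S} {P} path = subst (_< bound S P) (ℚ.*-zeroʳ ¾) (ℚ.*-monoʳ-<-pos ¾ (ι-< (eta-positive S P path)))

  incidencesAt unrelatedAt : Subset n → List (Fin n) → Fin n → ℕ
  incidencesAt S P x = ∑[ v < n ] 𝟙 (related S P x ∧ inChild S P x v)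
  unrelatedAt S P x = 𝟙 (lookup S x ∧ not (related S P x))

  module _ (S₀ : Subset n) (P₀ : List (Fin n)) where

    pivotValue : ℕ → Subset n → List (Fin n) → Fin n → ℚ
    pivotValue k S P x = if related S P x then ι (eta' S₀ P₀ (children S P x)) else flatE k S₀ P₀ (VR S x) P

    eta'≤inChild : ∀ S P x → eta' S₀ P₀ (children S P x) ℕ.≤ ∑[ v < n ] 𝟙 (inChild S P x v)
    eta'≤inChild S P x = ℕ.≤-trans (ℕ.≤-reflexive (count-tabulate (λ v → active S₀ P₀ v ∧ inChild S P x v)))
      (∑-mono-≤ (λ v → 𝟙-mono (∧-conicalʳ (active S₀ P₀ v) (inChild S P x v))))

    -- Stated for any r equal to `related S P x` so that no with-abstraction normalises the rational goal.
    pivotValue-≤ : ∀ k S P → IsPath E S P → (∀ S′ P′ → IsPath E S′ P′ → flatE k S₀ P₀ S′ P′ < bound S′ P′) →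
      ∀ x → lookup S x ≡ true → ∀ r → related S P x ≡ r →
      (if r then ι (eta' S₀ P₀ (children S P x)) else flatE k S₀ P₀ (VR S x) P) ≤
      ι (∑[ v < n ] 𝟙 (r ∧ inChild S P x v)) + bound S P * ι (𝟙 (lookup S x ∧ not r))
    pivotValue-≤ k S P path flatE< x x∈S true _ = begin
      ι (eta' S₀ P₀ (children S P x))            ≤⟨ ι-≤ (eta'≤inChild S P x) ⟩
      ι inc                                      ≡⟨ sym (ℚ.+-identityʳ (ι inc)) ⟩
      ι inc + 0ℚ                                 ≡⟨ cong (λ z → ι inc + z) (sym (ℚ.*-zeroʳ (bound S P))) ⟩
      ι inc + bound S P * 0ℚ                     ≡⟨ cong (λ b → ι inc + bound S P * ι (𝟙 b)) (sym (∧-zeroʳ (lookup S x))) ⟩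
      ι inc + bound S P * ι (𝟙 (lookup S x ∧ false)) ∎
      where
      open ℚ.≤-Reasoning
      inc : ℕ
      inc = ∑[ v < n ] 𝟙 (inChild S P x v)
    pivotValue-≤ k S P path flatE< x x∈S false unrelated = begin
      flatE k S₀ P₀ (VR S x) P                   <⟨ flatE< (VR S x) P (IsPath-VR path unrelated) ⟩
      bound (VR S x) P                           ≤⟨ ℚ.*-monoˡ-≤-nonNeg ¾ (ι-≤ (eta-VR≤eta S P x)) ⟩
      bound S P                                  ≡⟨ sym (trans (ℚ.+-identityˡ (bound S P * 1ℚ)) (ℚ.*-identityʳ (bound S P))) ⟩
      0ℚ + bound S P * 1ℚ                        ≤⟨ ℚ.+-monoˡ-≤ (bound S P * 1ℚ) (ι-nonNeg (∑[ v < n ] 𝟙 (false ∧ inChild S P x v))) ⟩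
      ι (∑[ v < n ] 𝟙 (false ∧ inChild S P x v)) + bound S P * 1ℚ
        ≡⟨ cong (λ b → ι (∑[ v < n ] 𝟙 (false ∧ inChild S P x v)) + bound S P * ι (𝟙 b)) (sym (trans (∧-identityʳ (lookup S x)) x∈S)) ⟩
      ι (∑[ v < n ] 𝟙 (false ∧ inChild S P x v)) + bound S P * ι (𝟙 (lookup S x ∧ true)) ∎
      where open ℚ.≤-Reasoning

    flatE<bound : ∀ k S P → IsPath E S P → flatE k S₀ P₀ S P < bound S P
    flatE<bound zero S P path = bound-positive path
    flatE<bound (suc k) S P path = avg-< S (pivotValue k S P) (bound-positive path) (begin-strict
      sumOver S (pivotValue k S P)
        ≤⟨ sumOver-≤ S (pivotValue k S P) (incidencesAt S P) (unrelatedAt S P) (ℚ.<⇒≤ (bound-positive path))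
             (λ x x∈S → pivotValue-≤ k S P path (flatE<bound k) x x∈S (related S P x) refl) ⟩
      ι (incidences S P) + B * ι unrelated     <⟨ ℚ.+-monoˡ-< (B * ι unrelated) (ι<¾*ι*ι {incidences S P} {eta S P} (incidences-bound S P path)) ⟩
      B * ι (eta S P) + B * ι unrelated        ≡⟨ sym (ℚ.*-distribˡ-+ B (ι (eta S P)) (ι unrelated)) ⟩
      B * (ι (eta S P) + ι unrelated)          ≡⟨ cong (B *_) (sym (ι-+ (eta S P) unrelated)) ⟩
      B * ι (eta S P ℕ.+ unrelated)            ≡⟨ cong (λ m → B * ι m) (trans (ℕ.+-comm (eta S P) unrelated) (unrelated+eta≡size S P)) ⟩
      B * ι ∣ S ∣                               ∎)
      where
      open ℚ.≤-Reasoning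
      B : ℚ
      B = bound S P
      unrelated : ℕ
      unrelated = sum (unrelatedAt S P)

open import Data.Integer using (+_)
open import Data.Rational using (_<_; _*_; _/_)

lemma5 : (n : ℕ) (E : Graph n) (dec : ReachDec E) (S : Subset n) (P : List (Fin n)) →
    IsPath E S P →
    Procedure.expectedEta' E dec S P < ((+ 3) / 4) * ((+ Procedure.eta E dec S P) / 1)
lemma5 n E dec S P path = Expectation.flatE<bound E dec S P n S P path
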